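{- Let $k,r$ be integers with $r\ge1$ and $k-r-1\ge0$. For integers $m\geq1$ and $t$ with $t^2<4m$, $$|P_{k,r}(t,m)|\leq\binom{k-2}{r-1}\frac{2^r m^{(k-1)/2}}{(4m-t^2)^{r/2}}.$$
   Context: $P_{k,r}(t,m)$ denotes the coefficient of $x^{k-r-1}$ in the power series expansion of $(1-tx+mx^2)^{ -r}$. -}

module Defs where

open import Data.Nat using (ℕ; zero; suc; _∸_)
open import Data.Integer using (ℤ; +_; _+_; _-_; _*_)

Series : Set
Series = ℕ → ℤ

sumTo : ℕ → (ℕ → ℤ) → ℤ
sumTo zero    f = f 0
sumTo (suc n) f = sumTo n f + f (suc n)

_⊛_ : Series → Series → Series
(f ⊛ g) n = sumTo n (λ i → f i * g (n ∸ i))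

oneS : Series
oneS zero    = + 1
oneS (suc _) = + 0

-- Power series expansion of (1 - t x + m x^2)^{-1}: the unique series b with
-- (1 - t x + m x^2) b = 1, i.e. b0 = 1, b1 = t, b(n+2) = t b(n+1) - m b(n).
invQuad : ℤ → ℤ → Series
invQuad t m zero          = + 1
invQuad t m (suc zero)    = t
invQuad t m (suc (suc n)) = t * invQuad t m (suc n) - m * invQuad t m n

powS : ℕ → Series → Series
powS zero    f = oneS
powS (suc r) f = f ⊛ powS r f

P : ℕ → ℕ → ℤ → ℤ → ℤ
P k r t m = powS r (invQuad t m) (k ∸ r ∸ 1)

-- Let b be the coefficient sequence of (1 − tx + mx²)⁻¹ and D = 4m − t². Cassini's identity
-- b(n+1)² − t b(n+1) b(n) + m b(n)² = m^(n+1), multiplied by 4m and completed to a square,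
-- gives ∣b(n)∣ √D ≤ √(4m · mⁿ). Bounds of the shape ∣f(n)∣ √E ≤ a(n) √(c wⁿ) survive sums
-- (Cauchy–Schwarz) and products with the same w, hence Cauchy products; so the n-th
-- coefficient of b^r is bounded as claimed with a = coefficients of (1 − x)^(−r), which are
-- binomial coefficients.
module Submission where

open import Defs
open import Data.Nat.Combinatorics using (_C_)
open import Data.Nat using (ℕ; _∸_) renaming (_≤_ to _≤ℕ_; _+_ to _+ℕ_)
open import Data.Integer using (ℤ; +_; _-_; _*_; _^_; _≤_; _<_)

open import Data.Nat using (zero; suc; z≤n)
import Data.Nat.Properties as ℕ
open import Data.Nat.Combinatorics using (nCn≡1; nCk+nC[k+1]≡[n+1]C[k+1])
open import Data.Integer using (0ℤ; -[1+_]; +≤+; _+_; positive; nonNegative)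
open import Data.Integer.Properties
open import Data.Integer.Tactic.RingSolver using (solve-∀)
open import Data.Nat.Tactic.RingSolver using () renaming (solve-∀ to ℕ-solve-∀)
open import Function using (_∘_)
open import Relation.Binary.PropositionalEquality
open import Relation.Nullary using (yes; no; contradiction)

*-nonNeg : ∀ {i j} → 0ℤ ≤ i → 0ℤ ≤ j → 0ℤ ≤ i * j
*-nonNeg {i} {j} 0≤i 0≤j =
  subst (_≤ i * j) (*-zeroʳ i) (*-monoˡ-≤-nonNeg i {{nonNegative 0≤i}} 0≤j)

^-nonNeg : ∀ {i} → 0ℤ ≤ i → ∀ n → 0ℤ ≤ i ^ n
^-nonNeg 0≤i zero    = +≤+ z≤n
^-nonNeg 0≤i (suc n) = *-nonNeg 0≤i (^-nonNeg 0≤i n)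

0≤i*i : ∀ i → 0ℤ ≤ i * i
0≤i*i (+ n)    = *-nonNeg {+ n} {+ n} (+≤+ z≤n) (+≤+ z≤n)
0≤i*i -[1+ n ] = +≤+ z≤n

*-mono-≤-nonNeg : ∀ {i j k l} → 0ℤ ≤ i → 0ℤ ≤ k → i ≤ j → k ≤ l → i * k ≤ j * l
*-mono-≤-nonNeg {i} {j} {k} {l} 0≤i 0≤k i≤j k≤l = ≤-trans
  (*-monoˡ-≤-nonNeg i {{nonNegative 0≤i}} k≤l)
  (*-monoʳ-≤-nonNeg l {{nonNegative (≤-trans 0≤k k≤l)}} i≤j)

i*i≤j*j⇒i≤j : ∀ {i j} → 0ℤ ≤ j → i * i ≤ j * j → i ≤ j
i*i≤j*j⇒i≤j {i} {j} 0≤j i*i≤j*j with i ≤? j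
... | yes i≤j = i≤j
... | no  i≰j = contradiction i*i≤j*j (<⇒≱ j*j<i*i)
  where
  j<i : j < i
  j<i = ≰⇒> i≰j
  j*j<i*i : j * j < i * i
  j*j<i*i = ≤-<-trans (*-monoˡ-≤-nonNeg j {{nonNegative 0≤j}} (<⇒≤ j<i))
                      (*-monoʳ-<-pos i {{positive (≤-<-trans 0≤j j<i)}} j<i)

-- x ·√ E ≲ a ·√ F encodes ∣x∣ √E ≤ a √F (for a ≥ 0), squared so as to stay in ℤ.
infix 4 _·√_≲_·√_
_·√_≲_·√_ : ℤ → ℤ → ℤ → ℤ → Set
x ·√ E ≲ a ·√ F = x * x * E ≤ a * a * F

≲-+ : ∀ {x y a b E F} → 0ℤ ≤ E → 0ℤ ≤ F → 0ℤ ≤ a → 0ℤ ≤ b →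
      x ·√ E ≲ a ·√ F → y ·√ E ≲ b ·√ F → x + y ·√ E ≲ a + b ·√ F
≲-+ {x} {y} {a} {b} {E} {F} 0≤E 0≤F 0≤a 0≤b x≲a y≲b =
  subst₂ _≤_ (sym (expand x y E)) (sym (expand a b F))
    (+-mono-≤ (+-mono-≤ x≲a (+-mono-≤ cross cross)) y≲b)
  where
  expand : ∀ x y E → (x + y) * (x + y) * E ≡ x * x * E + (x * y * E + x * y * E) + y * y * E
  expand = solve-∀
  square : ∀ x y E → (x * y * E) * (x * y * E) ≡ (x * x * E) * (y * y * E)
  square = solve-∀
  -- (xyE)² = (x²E)(y²E) ≤ (a²F)(b²F) = (abF)².
  cross : x * y * E ≤ a * b * F
  cross = i*i≤j*j⇒i≤j (*-nonNeg (*-nonNeg 0≤a 0≤b) 0≤F)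
    (subst₂ _≤_ (sym (square x y E)) (sym (square a b F))
      (*-mono-≤-nonNeg (*-nonNeg (0≤i*i x) 0≤E) (*-nonNeg (0≤i*i y) 0≤E) x≲a y≲b))

≲-* : ∀ {x y a b E E′ F F′} → 0ℤ ≤ E → 0ℤ ≤ E′ →
      x ·√ E ≲ a ·√ F → y ·√ E′ ≲ b ·√ F′ → x * y ·√ E * E′ ≲ a * b ·√ F * F′
≲-* {x} {y} {a} {b} {E} {E′} {F} {F′} 0≤E 0≤E′ x≲a y≲b =
  subst₂ _≤_ (regroup x y E E′) (regroup a b F F′)
    (*-mono-≤-nonNeg (*-nonNeg (0≤i*i x) 0≤E) (*-nonNeg (0≤i*i y) 0≤E′) x≲a y≲b)
  where
  regroup : ∀ x y E E′ → (x * x * E) * (y * y * E′) ≡ (x * y) * (x * y) * (E * E′)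
  regroup = solve-∀

sumTo-nonNeg : ∀ n {f} → (∀ i → 0ℤ ≤ f i) → 0ℤ ≤ sumTo n f
sumTo-nonNeg zero    0≤f = 0≤f 0
sumTo-nonNeg (suc n) 0≤f = +-mono-≤ (sumTo-nonNeg n 0≤f) (0≤f (suc n))

≲-sumTo : ∀ n {f g E F} → 0ℤ ≤ E → 0ℤ ≤ F → (∀ i → 0ℤ ≤ g i) →
          (∀ i → i ≤ℕ n → f i ·√ E ≲ g i ·√ F) → sumTo n f ·√ E ≲ sumTo n g ·√ F
≲-sumTo zero    0≤E 0≤F 0≤g f≲g = f≲g 0 z≤n
≲-sumTo (suc n) {f} {g} 0≤E 0≤F 0≤g f≲g =
  ≲-+ {sumTo n f} {f (suc n)} 0≤E 0≤F (sumTo-nonNeg n 0≤g) (0≤g (suc n))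
    (≲-sumTo n {f} {g} 0≤E 0≤F 0≤g (λ i i≤n → f≲g i (ℕ.m≤n⇒m≤1+n i≤n)))
    (f≲g (suc n) ℕ.≤-refl)

Majorised : (E c w : ℤ) → Series → Series → Set
Majorised E c w f a = ∀ n → f n ·√ E ≲ a n ·√ c * w ^ n

geometric-weight : ∀ c c′ w {i n} → i ≤ℕ n → (c * w ^ i) * (c′ * w ^ (n ∸ i)) ≡ (c * c′) * w ^ n
geometric-weight c c′ w {i} {n} i≤n = begin
  (c * w ^ i) * (c′ * w ^ (n ∸ i))  ≡⟨ regroup c c′ (w ^ i) (w ^ (n ∸ i)) ⟩
  (c * c′) * (w ^ i * w ^ (n ∸ i))  ≡⟨ cong ((c * c′) *_) (^-distribˡ-+-* w i (n ∸ i)) ⟨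
  (c * c′) * w ^ (i +ℕ (n ∸ i))     ≡⟨ cong (λ e → (c * c′) * w ^ e) (ℕ.m+[n∸m]≡n i≤n) ⟩
  (c * c′) * w ^ n                  ∎
  where
  open ≡-Reasoning
  regroup : ∀ a b x y → (a * x) * (b * y) ≡ (a * b) * (x * y)
  regroup = solve-∀

⊛-nonNeg : ∀ {a b} → (∀ n → 0ℤ ≤ a n) → (∀ n → 0ℤ ≤ b n) → ∀ n → 0ℤ ≤ (a ⊛ b) n
⊛-nonNeg 0≤a 0≤b n = sumTo-nonNeg n (λ i → *-nonNeg (0≤a i) (0≤b (n ∸ i)))

Majorised-⊛ : ∀ {E E′ c c′ w f g a b} → 0ℤ ≤ E → 0ℤ ≤ E′ → 0ℤ ≤ c → 0ℤ ≤ c′ → 0ℤ ≤ w →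
              (∀ n → 0ℤ ≤ a n) → (∀ n → 0ℤ ≤ b n) →
              Majorised E c w f a → Majorised E′ c′ w g b →
              Majorised (E * E′) (c * c′) w (f ⊛ g) (a ⊛ b)
Majorised-⊛ {E} {E′} {c} {c′} {w} {f} {g} {a} {b} 0≤E 0≤E′ 0≤c 0≤c′ 0≤w 0≤a 0≤b f≲a g≲b n =
  ≲-sumTo n (*-nonNeg 0≤E 0≤E′) (*-nonNeg (*-nonNeg 0≤c 0≤c′) (^-nonNeg 0≤w n))
    (λ i → *-nonNeg (0≤a i) (0≤b (n ∸ i))) term
  where
  term : ∀ i → i ≤ℕ n → f i * g (n ∸ i) ·√ E * E′ ≲ a i * b (n ∸ i) ·√ (c * c′) * w ^ n
  term i i≤n = subst (λ F → f i * g (n ∸ i) ·√ E * E′ ≲ a i * b (n ∸ i) ·√ F)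
    (geometric-weight c c′ w i≤n)
    (≲-* {f i} {g (n ∸ i)} {a i} {b (n ∸ i)} 0≤E 0≤E′ (f≲a i) (g≲b (n ∸ i)))

powS-nonNeg : ∀ {a} → (∀ n → 0ℤ ≤ a n) → ∀ r n → 0ℤ ≤ powS r a n
powS-nonNeg 0≤a zero    zero    = +≤+ z≤n
powS-nonNeg 0≤a zero    (suc n) = +≤+ z≤n
powS-nonNeg 0≤a (suc r) n       = ⊛-nonNeg 0≤a (powS-nonNeg 0≤a r) n

Majorised-powS : ∀ {E c w f a} → 0ℤ ≤ E → 0ℤ ≤ c → 0ℤ ≤ w → (∀ n → 0ℤ ≤ a n) →
                 Majorised E c w f a → ∀ r → Majorised (E ^ r) (c ^ r) w (powS r f) (powS r a)
Majorised-powS 0≤E 0≤c 0≤w 0≤a f≲a zero    zero    = ≤-refl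
Majorised-powS 0≤E 0≤c 0≤w 0≤a f≲a zero    (suc n) = ≤-refl
Majorised-powS {f = f} {a} 0≤E 0≤c 0≤w 0≤a f≲a (suc r) =
  Majorised-⊛ {f = f} {powS r f} {a} {powS r a} 0≤E (^-nonNeg 0≤E r) 0≤c (^-nonNeg 0≤c r) 0≤w 0≤a (powS-nonNeg 0≤a r)
    f≲a (Majorised-powS 0≤E 0≤c 0≤w 0≤a f≲a r)

invQuad-cassini : ∀ t m n → let y = invQuad t m (suc n); x = invQuad t m n in
                  y * y - t * y * x + m * x * x ≡ m ^ suc n
invQuad-cassini t m zero    = base t m
  where
  base : ∀ t m → t * t - t * t * + 1 + m * + 1 * + 1 ≡ m * + 1
  base = solve-∀
invQuad-cassini t m (suc n) =
  trans (step t m (invQuad t m (suc n)) (invQuad t m n)) (cong (m *_) (invQuad-cassini t m n))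
  where
  step : ∀ t m y x → (t * y - m * x) * (t * y - m * x) - t * (t * y - m * x) * y + m * y * y
                   ≡ m * (y * y - t * y * x + m * x * x)
  step = solve-∀

ones : Series
ones _ = + 1

i+j*j≡k⇒i≤k : ∀ i j {k} → i + j * j ≡ k → i ≤ k
i+j*j≡k⇒i≤k i j refl = i≤i+j i (j * j) {{nonNegative (0≤i*i j)}}

-- Multiplying Cassini's identity by 4m gives
-- 4m · m^(n+1) = (4m − t²) y² + (2mx − ty)².
invQuad-majorised : ∀ t m → Majorised (+ 4 * m - t * t) (+ 4 * m) m (invQuad t m) ones
invQuad-majorised t m zero    = i+j*j≡k⇒i≤k (+ 1 * + 1 * (+ 4 * m - t * t)) t (base t m)
  where
  base : ∀ t m → + 1 * + 1 * (+ 4 * m - t * t) + t * t ≡ + 1 * + 1 * (+ 4 * m * + 1)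
  base = solve-∀
invQuad-majorised t m (suc n) =
  i+j*j≡k⇒i≤k (y * y * (+ 4 * m - t * t)) (+ 2 * m * x - t * y) (begin
    y * y * (+ 4 * m - t * t) + (+ 2 * m * x - t * y) * (+ 2 * m * x - t * y)
      ≡⟨ complete-square t m y x ⟩
    + 1 * + 1 * (+ 4 * m * (y * y - t * y * x + m * x * x))
      ≡⟨ cong (λ e → + 1 * + 1 * (+ 4 * m * e)) (invQuad-cassini t m n) ⟩
    + 1 * + 1 * (+ 4 * m * m ^ suc n) ∎)
  where
  open ≡-Reasoning
  y = invQuad t m (suc n)
  x = invQuad t m n
  complete-square : ∀ t m y x → y * y * (+ 4 * m - t * t) + (+ 2 * m * x - t * y) * (+ 2 * m * x - t * y)
                              ≡ + 1 * + 1 * (+ 4 * m * (y * y - t * y * x + m * x * x))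
  complete-square = solve-∀

sumTo-suc : ∀ n f → sumTo (suc n) f ≡ f 0 + sumTo n (f ∘ suc)
sumTo-suc zero    f = refl
sumTo-suc (suc n) f = trans (cong (_+ f (suc (suc n))) (sumTo-suc n f))
                            (+-assoc (f 0) (sumTo n (f ∘ suc)) (f (suc (suc n))))

ones-⊛-suc : ∀ g n → (ones ⊛ g) (suc n) ≡ g (suc n) + (ones ⊛ g) n
ones-⊛-suc g n = trans (sumTo-suc n (λ i → + 1 * g (suc n ∸ i)))
                       (cong (_+ (ones ⊛ g) n) (*-identityˡ (g (suc n))))

powS-ones : ∀ r n → powS (suc r) ones n ≡ + ((n +ℕ r) C r)
powS-ones zero    zero    = refl
powS-ones zero    (suc n) = trans (ones-⊛-suc oneS n) (trans (+-identityˡ _) (powS-ones zero n))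
powS-ones (suc r) zero    = begin
  + 1 * powS (suc r) ones 0  ≡⟨ *-identityˡ _ ⟩
  powS (suc r) ones 0        ≡⟨ powS-ones r 0 ⟩
  + (r C r)                  ≡⟨ cong +_ (trans (nCn≡1 r) (sym (nCn≡1 (suc r)))) ⟩
  + (suc r C suc r)          ∎
  where open ≡-Reasoning
powS-ones (suc r) (suc n) = begin
  powS (suc (suc r)) ones (suc n)                          ≡⟨ ones-⊛-suc (powS (suc r) ones) n ⟩
  powS (suc r) ones (suc n) + powS (suc (suc r)) ones n    ≡⟨ cong₂ _+_ (powS-ones r (suc n)) (powS-ones (suc r) n) ⟩
  + ((suc n +ℕ r) C r) + + ((n +ℕ suc r) C suc r)          ≡⟨ cong (λ j → + (j C r) + + ((n +ℕ suc r) C suc r)) (ℕ.+-suc n r) ⟨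
  + ((n +ℕ suc r) C r) + + ((n +ℕ suc r) C suc r)          ≡⟨ pos-+ ((n +ℕ suc r) C r) ((n +ℕ suc r) C suc r) ⟨
  + ((n +ℕ suc r) C r +ℕ (n +ℕ suc r) C suc r)             ≡⟨ cong +_ (nCk+nC[k+1]≡[n+1]C[k+1] (n +ℕ suc r) r) ⟩
  + (suc (n +ℕ suc r) C suc r)                             ∎
  where open ≡-Reasoning

^-distrib-* : ∀ i j n → (i * j) ^ n ≡ i ^ n * j ^ n
^-distrib-* i j zero    = refl
^-distrib-* i j (suc n) = trans (cong ((i * j) *_) (^-distrib-* i j n)) (regroup i j (i ^ n) (j ^ n))
  where
  regroup : ∀ a b x y → (a * b) * (x * y) ≡ (a * x) * (b * y)
  regroup = solve-∀

i^2≡i*i : ∀ i → i ^ 2 ≡ i * i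
i^2≡i*i i = cong (i *_) (*-identityʳ i)

[i*j]^r*j^n≡i^r*j^[n+r] : ∀ i j r n → (i * j) ^ r * j ^ n ≡ i ^ r * j ^ (n +ℕ r)
[i*j]^r*j^n≡i^r*j^[n+r] i j r n = begin
  (i * j) ^ r * j ^ n      ≡⟨ cong (_* j ^ n) (^-distrib-* i j r) ⟩
  i ^ r * j ^ r * j ^ n    ≡⟨ *-assoc (i ^ r) (j ^ r) (j ^ n) ⟩
  i ^ r * (j ^ r * j ^ n)  ≡⟨ cong (i ^ r *_) (^-distribˡ-+-* j r n) ⟨
  i ^ r * j ^ (r +ℕ n)     ≡⟨ cong (λ e → i ^ r * j ^ e) (ℕ.+-comm r n) ⟩
  i ^ r * j ^ (n +ℕ r)     ∎
  where open ≡-Reasoning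

m∸[1+n]∸1+n+2≡m : ∀ {m} n → suc n +ℕ 1 ≤ℕ m → suc (suc (m ∸ suc n ∸ 1 +ℕ n)) ≡ m
m∸[1+n]∸1+n+2≡m {m} n 2+n≤m = begin
  suc (suc (m ∸ suc n ∸ 1 +ℕ n))         ≡⟨ shift (m ∸ suc n ∸ 1) n ⟩
  m ∸ suc n ∸ 1 +ℕ (suc n +ℕ 1)          ≡⟨ cong (_+ℕ (suc n +ℕ 1)) (ℕ.∸-+-assoc m (suc n) 1) ⟩
  m ∸ (suc n +ℕ 1) +ℕ (suc n +ℕ 1)       ≡⟨ ℕ.m∸n+n≡m 2+n≤m ⟩
  m                                      ∎
  where
  open ≡-Reasoning
  shift : ∀ a b → suc (suc (a +ℕ b)) ≡ a +ℕ (suc b +ℕ 1)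
  shift = ℕ-solve-∀

lemma3p1 : (k r : ℕ) → 1 ≤ℕ r → r +ℕ 1 ≤ℕ k →
    (m t : ℤ) → + 1 ≤ m → t * t < + 4 * m →
    (P k r t m ^ 2) * ((+ 4 * m - t * t) ^ r)
      ≤ ((+ ((k ∸ 2) C (r ∸ 1))) ^ 2) * ((+ 4) ^ r) * (m ^ (k ∸ 1))
lemma3p1 k zero    ()
lemma3p1 k (suc r) _ 2+r≤k m t 1≤m t*t<4m = begin
  P k (suc r) t m ^ 2 * D ^ suc r
    ≡⟨ cong (_* D ^ suc r) (i^2≡i*i (P k (suc r) t m)) ⟩
  powS (suc r) b n * powS (suc r) b n * D ^ suc r
    ≤⟨ Majorised-powS {f = b} {ones} 0≤D 0≤4m 0≤m (λ _ → +≤+ z≤n) (invQuad-majorised t m) (suc r) n ⟩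
  powS (suc r) ones n * powS (suc r) ones n * ((+ 4 * m) ^ suc r * m ^ n)
    ≡⟨ cong₂ (λ a e → a * a * e) (powS-ones r n) ([i*j]^r*j^n≡i^r*j^[n+r] (+ 4) m (suc r) n) ⟩
  + ((n +ℕ r) C r) * + ((n +ℕ r) C r) * ((+ 4) ^ suc r * m ^ (n +ℕ suc r))
    ≡⟨ cong₂ (λ j e → + (j C r) * + (j C r) * ((+ 4) ^ suc r * m ^ e)) (cong (_∸ 2) n+r+2≡k)
             (trans (ℕ.+-suc n r) (cong (_∸ 1) n+r+2≡k)) ⟩
  + ((k ∸ 2) C r) * + ((k ∸ 2) C r) * ((+ 4) ^ suc r * m ^ (k ∸ 1))
    ≡⟨ regroup (+ ((k ∸ 2) C r)) ((+ 4) ^ suc r) (m ^ (k ∸ 1)) ⟩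
  (+ ((k ∸ 2) C r)) ^ 2 * (+ 4) ^ suc r * m ^ (k ∸ 1) ∎
  where
  open ≤-Reasoning
  D = + 4 * m - t * t
  b = invQuad t m
  n = k ∸ suc r ∸ 1
  n+r+2≡k : suc (suc (n +ℕ r)) ≡ k
  n+r+2≡k = m∸[1+n]∸1+n+2≡m r 2+r≤k
  0≤m : 0ℤ ≤ m
  0≤m = ≤-trans (+≤+ z≤n) 1≤m
  0≤4m : 0ℤ ≤ + 4 * m
  0≤4m = *-nonNeg {+ 4} (+≤+ z≤n) 0≤m
  0≤D : 0ℤ ≤ D
  0≤D = i≤j⇒0≤j-i (<⇒≤ t*t<4m)
  regroup : ∀ c x y → c * c * (x * y) ≡ c ^ 2 * x * y
  regroup c x y = trans (sym (*-assoc (c * c) x y)) (cong (λ s → s * x * y) (sym (i^2≡i*i c)))
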